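{- Let $p$ be any pattern in the symmetry class of one of $(12,\{0\},\{0\})$, $(12,\{0\},\{0,1\})$, $(12,\{0\},\{0,2\})$, $(12,\{0\},\{1,2\})$, $(12,\{1\},\{0,1\})$, $(12,\{1\},\{0,2\})$. Then for all $n\ge 2$, $a_n(p)=n!-(n-1)!$.
   Context: A bi-vincular pattern of length $k$ is a triple $p=(\sigma,X,Y)$ with $\sigma$ a permutation of $[k]$ in one-line notation and $X,Y\subseteq\{0,1,\dots,k\}$. A permutation $\pi=\pi_1\cdots\pi_n$ of $[n]$ contains $p$ if there are indices $1\le i_1<\dots<i_k\le n$ such that $(\pi_{i_1},\dots,\pi_{i_k})$ is order-isomorphic to $\sigma$ and, writing $j_1<\dots<j_k$ for the set $\{\pi_{i_1},\dots,\pi_{i_k}\}$ in increasing order and setting $i_0=j_0=0$, $i_{k+1}=j_{k+1}=n+1$, we have $i_{x+1}=i_x+1$ for all $x\in X$ and $j_{y+1}=j_y+1$ for all $y\in Y$. Otherwise $\pi$ avoids $p$; $a_n(p)$ is the number of permutations of $[n]$ avoiding $p$. For $p=(\sigma,X,Y)$ of length $k$ define $p^{i}=(\sigma^{ -1},Y,X)$, $p^{r}=(\sigma^{r},\{k-x:x\in X\},Y)$, $p^{c}=(\sigma^{c},X,\{k-y:y\in Y\})$, with $\sigma^r_m=\sigma_{k+1-m}$ and $\sigma^c_m=k+1-\sigma_m$; the symmetry class of $p$ is the set of patterns obtained from $p$ by finite compositions of $i,r,c$. -}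

module Defs where

open import Data.Nat using (ℕ; zero; suc; _∸_; _!)
open import Data.Fin using (Fin; zero; suc; toℕ; inject₁; opposite; _<_)
open import Data.Fin.Subset using (Subset; _∈_)
open import Data.Fin.Permutation using (Permutation′; _⟨$⟩ʳ_; _⟨$⟩ˡ_; flip; reverse; _∘ₚ_; id)
open import Data.Vec using (Vec; lookup; tabulate; []; _∷_)
open import Data.Bool using (Bool; true; false)
open import Data.List using (List; length)
open import Data.List.Membership.Propositional renaming (_∈_ to _∈L_)
open import Data.List.Relation.Unary.Unique.Propositional using (Unique)
open import Data.Product using (Σ; ∃; _×_)
open import Function using (_∘_; _⇔_)
open import Relation.Binary.PropositionalEquality using (_≡_)
open import Relation.Nullary using (¬_)

-- Permutations of [n], in one-line notation.
-- A word π : Vec (Fin n) n stands for π₁ ⋯ πₙ with πᵢ = 1 + toℕ (lookup π (i-1)).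
-- It is a permutation of [n] iff the map i ↦ πᵢ is injective.

IsPerm : ∀ {n} → Vec (Fin n) n → Set
IsPerm {n} π = ∀ (i j : Fin n) → lookup π i ≡ lookup π j → i ≡ j

-- Bi-vincular patterns (σ, X, Y) of length k, with X, Y ⊆ {0,…,k}
-- represented as subsets of Fin (suc k).

record Pattern (k : ℕ) : Set where
  constructor pat
  field
    σ : Permutation′ k
    X : Subset (suc k)
    Y : Subset (suc k)

open Pattern public

-- Extension of a sequence f₁,…,f_k (given as f : Fin k → ℕ, f (m-1) = f_m)
-- to f₀ = 0, f_1, …, f_k, f_{k+1} = top, indexed by Fin (k+2).
extendTop : ∀ {k} → (Fin k → ℕ) → ℕ → Fin (suc k) → ℕ
extendTop {zero}  f t zero    = t
extendTop {suc k} f t zero    = f zero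
extendTop {suc k} f t (suc m) = extendTop (f ∘ suc) t m

extend : ∀ {k} → (Fin k → ℕ) → ℕ → Fin (suc (suc k)) → ℕ
extend f t zero    = 0
extend f t (suc m) = extendTop f t m

-- An occurrence of p in π: positions ι (so i_{a+1} = 1 + toℕ (ι a)).
Occurrence : ∀ {k n} → Pattern k → Vec (Fin n) n → (Fin k → Fin n) → Set
Occurrence {k} {n} p π ι =
  (∀ (a b : Fin k) → a < b → ι a < ι b)
  × (∀ (a b : Fin k) → (val a < val b ⇔ (σ p ⟨$⟩ʳ a) < (σ p ⟨$⟩ʳ b)))
  × (∀ (x : Fin (suc k)) → x ∈ X p → I (suc x) ≡ suc (I (inject₁ x)))
  × (∀ (y : Fin (suc k)) → y ∈ Y p → J (suc y) ≡ suc (J (inject₁ y)))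
  where
    val : Fin k → Fin n
    val a = lookup π (ι a)
    -- i₀ = 0, i_m = 1 + toℕ (ι (m-1)), i_{k+1} = n+1
    I : Fin (suc (suc k)) → ℕ
    I = extend (λ a → suc (toℕ (ι a))) (suc n)
    -- j_m = the m-th smallest of the chosen values; since the occurrence is
    -- order-isomorphic to σ, it is the value at position ι (σ⁻¹ (m-1)).
    -- j₀ = 0, j_{k+1} = n+1.
    J : Fin (suc (suc k)) → ℕ
    J = extend (λ m → suc (toℕ (val (σ p ⟨$⟩ˡ m)))) (suc n)

Contains : ∀ {k n} → Pattern k → Vec (Fin n) n → Set
Contains {k} {n} p π = ∃ λ (ι : Fin k → Fin n) → Occurrence p π ι

Avoids : ∀ {k n} → Pattern k → Vec (Fin n) n → Set
Avoids p π = ¬ Contains p π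

-- "a_n(p) = N": the permutations of [n] avoiding p are exactly the
-- entries of some duplicate-free list of length N.
AvoidCount : ∀ {k} → Pattern k → ℕ → ℕ → Set
AvoidCount p n N =
  Σ (List (Vec (Fin n) n)) λ L →
    Unique L
    × (∀ (π : Vec (Fin n) n) → (π ∈L L ⇔ (IsPerm π × Avoids p π)))
    × length L ≡ N

reflectSet : ∀ {k} → Subset (suc k) → Subset (suc k)
reflectSet S = tabulate (λ x → lookup S (opposite x))

_ⁱ : ∀ {k} → Pattern k → Pattern k
pat σ X Y ⁱ = pat (flip σ) Y X

-- p^r = (σ^r, {k-x}, Y),  σ^r_m = σ_{k+1-m}
_ʳ : ∀ {k} → Pattern k → Pattern k
pat σ X Y ʳ = pat (reverse ∘ₚ σ) (reflectSet X) Y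

-- p^c = (σ^c, X, {k-y}),  σ^c_m = k+1-σ_m
_ᶜ : ∀ {k} → Pattern k → Pattern k
pat σ X Y ᶜ = pat (σ ∘ₚ reverse) X (reflectSet Y)

data SymClass {k : ℕ} (p : Pattern k) : Pattern k → Set where
  base : SymClass p p
  viaI : ∀ {q} → SymClass p q → SymClass p (q ⁱ)
  viaR : ∀ {q} → SymClass p q → SymClass p (q ʳ)
  viaC : ∀ {q} → SymClass p q → SymClass p (q ᶜ)

set : Bool → Bool → Bool → Subset 3
set b0 b1 b2 = b0 ∷ b1 ∷ b2 ∷ []

data Base : Pattern 2 → Set where
  b1 : Base (pat id (set true false false) (set true false false))
  b2 : Base (pat id (set true false false) (set true true false))
  b3 : Base (pat id (set true false false) (set true false true))
  b4 : Base (pat id (set true false false) (set false true true))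
  b5 : Base (pat id (set false true false) (set true true false))
  b6 : Base (pat id (set false true false) (set true false true))

module Submission where

-- A length-2 pattern matters only through whether σ is ascending and through
-- X, Y ⊆ {0,1,2}: an occurrence is a pair of positions a < c whose letters are
-- in the prescribed order and whose extended position and letter sequences
-- have width-one gaps where X and Y demand it ('Occ').

open import Defs
open import Data.Bool using (Bool; true; false; not; if_then_else_)
open import Data.Bool.Properties using (not-involutive; if-float)
open import Data.Empty using (⊥-elim)
open import Data.Fin as F using (Fin; suc; toℕ; inject₁; fromℕ; opposite; punchIn; punchOut)
open import Data.Fin.Patterns using (0F; 1F; 2F)
open import Data.Fin.Permutation using (Permutation′; _⟨$⟩ʳ_; _⟨$⟩ˡ_; inverseˡ; flip; reverse; _∘ₚ_)
open import Data.Fin.Properties as FP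
  using (any?; toℕ-injective; toℕ-inject₁; toℕ-fromℕ; toℕ<n; fromℕ≢inject₁; opposite-prop;
         opposite-involutive; punchIn-injective; punchInᵢ≢i; punchOut-injective; punchIn-punchOut;
         injective⇒≤)
open import Data.Fin.Subset using (Subset; _∈_)
open import Data.List as L using (List; []; _∷_; length; filter; allFin; cartesianProduct)
open import Data.List.Membership.Propositional renaming (_∈_ to _∈L_)
open import Data.List.Membership.Propositional.Properties
  using (∈-map⁺; ∈-map⁻; ∈-cartesianProduct⁺; ∈-cartesianProduct⁻; ∈-allFin; ∈-filter⁺; ∈-filter⁻)
open import Data.List.Membership.Propositional.Properties.WithK using (unique∧set⇒bag)
open import Data.List.Properties using (length-map; length-++; length-tabulate)
open import Data.List.Relation.Binary.BagAndSetEquality using (∼bag⇒↭)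
open import Data.List.Relation.Binary.Permutation.Propositional.Properties using (↭-length)
open import Data.List.Relation.Unary.All as All using (All; []; _∷_)
import Data.List.Relation.Unary.All.Properties as AllP
open import Data.List.Relation.Unary.AllPairs using ([]; _∷_)
open import Data.List.Relation.Unary.Any using (here)
open import Data.List.Relation.Unary.Unique.Propositional using (Unique)
open import Data.List.Relation.Unary.Unique.Propositional.Properties using (map⁺; cartesianProduct⁺; allFin⁺; filter⁺)
open import Data.Nat as ℕ using (ℕ; zero; suc; _+_; _*_; _∸_; _!; _≤_; z≤n; s≤s)
open import Data.Nat.Properties
  using (suc-injective; +-suc; +-comm; +-cancelʳ-≡; +-cancelʳ-<; +-monoʳ-<; m∸n+n≡m; m+n∸m≡n; 1+n≰n; n<1+n)
open import Data.Product using (Σ; ∃; _×_; _,_; proj₁; proj₂; uncurry)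
open import Data.Vec as V using (Vec; []; _∷_; lookup; tabulate)
open import Data.Vec.Properties
  using (∷-injective; lookup-map; map-∘; map-cong; map-id; lookup∘tabulate; tabulate∘lookup; tabulate-cong;
         tabulate-∘; []=⇒lookup; lookup⇒[]=)
open import Level using (0ℓ)
open import Function using (_∘_; id; _⇔_; mk⇔; Equivalence; Injective)
open import Function.Construct.Symmetry using (⇔-sym)
open import Function.Related.TypeIsomorphisms using (¬-cong-⇔)
open import Relation.Binary.PropositionalEquality
open import Relation.Nullary using (¬_; yes; no)
open import Relation.Nullary.Negation using (contradiction)
open import Relation.Unary using (Pred; Decidable)
open import Relation.Unary.Properties using (∁?)

Word : ℕ → Set
Word n = Vec (Fin n) n

PermCount : ∀ {n} → (Word n → Set) → ℕ → Set
PermCount {n} P N = Σ (List (Word n)) λ L →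
  Unique L × (∀ π → (π ∈L L ⇔ (IsPerm π × P π))) × length L ≡ N


-- Enumerating the permutations of [n] by their first letter.

prepend : ∀ {n} → Fin (suc n) → Word n → Word (suc n)
prepend a ρ = a ∷ V.map (punchIn a) ρ

perms : ∀ n → List (Word n)
perms zero    = [] ∷ []
perms (suc n) = L.map (uncurry prepend) (cartesianProduct (allFin (suc n)) (perms n))

map-punchIn-injective : ∀ {n m} (a : Fin (suc n)) {ρ τ : Vec (Fin n) m} →
  V.map (punchIn a) ρ ≡ V.map (punchIn a) τ → ρ ≡ τ
map-punchIn-injective a {[]}    {[]}    _ = refl
map-punchIn-injective a {x ∷ ρ} {y ∷ τ} e =
  cong₂ _∷_ (punchIn-injective a x y (proj₁ (∷-injective e))) (map-punchIn-injective a (proj₂ (∷-injective e)))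

prepend-injective : ∀ {n} → Injective _≡_ _≡_ (uncurry (prepend {n}))
prepend-injective {x = a , ρ} {b , τ} e with ∷-injective e
... | refl , e′ = cong (a ,_) (map-punchIn-injective a e′)

perms-unique : ∀ n → Unique (perms n)
perms-unique zero    = [] ∷ []
perms-unique (suc n) = map⁺ prepend-injective (cartesianProduct⁺ (allFin⁺ (suc n)) (perms-unique n))

length-cartesianProduct : ∀ {A B : Set} (xs : List A) (ys : List B) →
  length (cartesianProduct xs ys) ≡ length xs * length ys
length-cartesianProduct []       ys = refl
length-cartesianProduct (x ∷ xs) ys = begin
  length (L.map (x ,_) ys L.++ cartesianProduct xs ys)
    ≡⟨ length-++ (L.map (x ,_) ys) ⟩
  length (L.map (x ,_) ys) + length (cartesianProduct xs ys)
    ≡⟨ cong₂ _+_ (length-map (x ,_) ys) (length-cartesianProduct xs ys) ⟩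
  length ys + length xs * length ys
    ∎
  where open ≡-Reasoning

perms-length : ∀ n → length (perms n) ≡ n !
perms-length zero    = refl
perms-length (suc n) = begin
  length (L.map (uncurry prepend) pairs) ≡⟨ length-map _ pairs ⟩
  length pairs                           ≡⟨ length-cartesianProduct (allFin (suc n)) (perms n) ⟩
  length (allFin (suc n)) * length (perms n) ≡⟨ cong₂ _*_ (length-tabulate {n = suc n} id) (perms-length n) ⟩
  suc n * n !                            ∎
  where
  open ≡-Reasoning
  pairs : List (Fin (suc n) × Word n)
  pairs = cartesianProduct (allFin (suc n)) (perms n)

prepend-IsPerm : ∀ {n} (a : Fin (suc n)) (ρ : Word n) → IsPerm ρ → IsPerm (prepend a ρ)
prepend-IsPerm a ρ p 0F      0F      e = refl
prepend-IsPerm a ρ p 0F      (suc j) e rewrite lookup-map j (punchIn a) ρ = ⊥-elim (punchInᵢ≢i a _ (sym e))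
prepend-IsPerm a ρ p (suc i) 0F      e rewrite lookup-map i (punchIn a) ρ = ⊥-elim (punchInᵢ≢i a _ e)
prepend-IsPerm a ρ p (suc i) (suc j) e rewrite lookup-map i (punchIn a) ρ | lookup-map j (punchIn a) ρ =
  cong suc (p i j (punchIn-injective a _ _ e))

module RemoveFirst {n} (a : Fin (suc n)) (τ : Vec (Fin (suc n)) n) (p : IsPerm (a ∷ τ)) where

  a≢τ : ∀ i → a ≢ lookup τ i
  a≢τ i e with p 0F (suc i) e
  ... | ()

  rest : Word n
  rest = tabulate (λ i → punchOut (a≢τ i))

  rest-IsPerm : IsPerm rest
  rest-IsPerm i j e rewrite lookup∘tabulate (λ i → punchOut (a≢τ i)) i | lookup∘tabulate (λ i → punchOut (a≢τ i)) j =
    FP.suc-injective (p (suc i) (suc j) (punchOut-injective (a≢τ i) (a≢τ j) e))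

  prepend-rest : prepend a rest ≡ a ∷ τ
  prepend-rest = cong (a ∷_) (begin
    V.map (punchIn a) (tabulate (λ i → punchOut (a≢τ i))) ≡⟨ tabulate-∘ (punchIn a) _ ⟨
    tabulate (λ i → punchIn a (punchOut (a≢τ i)))         ≡⟨ tabulate-cong (λ i → punchIn-punchOut (a≢τ i)) ⟩
    tabulate (lookup τ)                                   ≡⟨ tabulate∘lookup τ ⟩
    τ                                                     ∎)
    where open ≡-Reasoning

perms-sound : ∀ n (π : Word n) → π ∈L perms n → IsPerm π
perms-sound zero    [] _ ()
perms-sound (suc n) π m with ∈-map⁻ (uncurry prepend) m
... | (a , ρ) , m′ , refl =
  prepend-IsPerm a ρ (perms-sound n ρ (proj₂ (∈-cartesianProduct⁻ (allFin (suc n)) (perms n) m′)))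

perms-complete : ∀ n (π : Word n) → IsPerm π → π ∈L perms n
perms-complete zero    []      p = here refl
perms-complete (suc n) (a ∷ τ) p = subst (_∈L perms (suc n)) prepend-rest
  (∈-map⁺ (uncurry prepend) (∈-cartesianProduct⁺ (∈-allFin a) (perms-complete n rest rest-IsPerm)))
  where open RemoveFirst a τ p


-- Permutations are onto (pigeonhole), so they can be inverted.

-- If the letter v were missing, closing the gap at v would inject [n+1] into [n].
IsPerm-onto : ∀ {n} (π : Word n) → IsPerm π → ∀ v → ∃ λ i → lookup π i ≡ v
IsPerm-onto {suc n} π p v with any? (λ i → lookup π i FP.≟ v)
... | yes hit  = hit
... | no  miss = contradiction (injective⇒≤ avoid-injective) 1+n≰n
  where
  avoid : Fin (suc n) → Fin n
  avoid i = punchOut {i = v} (λ e → miss (i , sym e))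
  avoid-injective : Injective _≡_ _≡_ avoid
  avoid-injective {i} {j} e = p i j (punchOut-injective {i = v} _ _ e)

-- The position of the letter v in π (v itself if v does not occur).
positionOf : ∀ {n} → Word n → Fin n → Fin n
positionOf π v with any? (λ i → lookup π i FP.≟ v)
... | yes (i , _) = i
... | no _        = v

lookup-positionOf : ∀ {n} (π : Word n) → IsPerm π → ∀ v → lookup π (positionOf π v) ≡ v
lookup-positionOf π p v with any? (λ i → lookup π i FP.≟ v)
... | yes (_ , e) = e
... | no  miss    = contradiction (IsPerm-onto π p v) miss

positionOf-lookup : ∀ {n} (π : Word n) → IsPerm π → ∀ i → positionOf π (lookup π i) ≡ i
positionOf-lookup π p i = p _ _ (lookup-positionOf π p (lookup π i))


sameMembers⇒sameLength : ∀ {A : Set} {xs ys : List A} → Unique xs → Unique ys →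
  (∀ {z} → z ∈L xs ⇔ z ∈L ys) → length xs ≡ length ys
sameMembers⇒sameLength u v eq = ↭-length (∼bag⇒↭ (unique∧set⇒bag u v eq))

length-filter-split : ∀ {A : Set} {P : Pred A 0ℓ} (P? : Decidable P) (xs : List A) →
  length (filter P? xs) + length (filter (∁? P?) xs) ≡ length xs
length-filter-split P? []       = refl
length-filter-split P? (x ∷ xs) with P? x
... | yes _ = cong suc (length-filter-split P? xs)
... | no  _ = trans (+-suc _ _) (cong suc (length-filter-split P? xs))

countByFirstLetter : ∀ k (h : Word k → Fin (suc k)) {D : Pred (Word (suc k)) 0ℓ} (D? : Decidable D) →
  (∀ a ρ → D (prepend a ρ) ⇔ a ≡ h ρ) → length (filter D? (perms (suc k))) ≡ k !
countByFirstLetter k h {D} D? spec = begin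
  length (filter D? (perms (suc k)))
    ≡⟨ sameMembers⇒sameLength (filter⁺ D? (perms-unique (suc k))) (map⁺ choose-injective (perms-unique k)) (mk⇔ to from) ⟩
  length (L.map choose (perms k))    ≡⟨ length-map choose (perms k) ⟩
  length (perms k)                   ≡⟨ perms-length k ⟩
  k !                                ∎
  where
  open ≡-Reasoning
  choose : Word k → Word (suc k)
  choose ρ = prepend (h ρ) ρ
  choose-injective : Injective _≡_ _≡_ choose
  choose-injective e = cong proj₂ (prepend-injective e)
  to : ∀ {π} → π ∈L filter D? (perms (suc k)) → π ∈L L.map choose (perms k)
  to m with ∈-filter⁻ D? {xs = perms (suc k)} m
  ... | m′ , d with ∈-map⁻ (uncurry prepend) m′
  ... | (a , ρ) , m″ , refl with Equivalence.to (spec a ρ) d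
  ... | refl = ∈-map⁺ choose (proj₂ (∈-cartesianProduct⁻ (allFin (suc k)) (perms k) m″))
  from : ∀ {π} → π ∈L L.map choose (perms k) → π ∈L filter D? (perms (suc k))
  from m with ∈-map⁻ choose m
  ... | ρ , m′ , refl = ∈-filter⁺ D? (∈-map⁺ (uncurry prepend) (∈-cartesianProduct⁺ (∈-allFin (h ρ)) m′))
                                     (Equivalence.from (spec (h ρ) ρ) refl)

firstLetterCount : ∀ k (v : Fin (suc k)) →
  length (filter (λ (π : Word (suc k)) → lookup π 0F FP.≟ v) (perms (suc k))) ≡ k !
firstLetterCount k v = countByFirstLetter k (λ _ → v) _ (λ a ρ → mk⇔ id id)

punchIn≡suc⇒ : ∀ {k} (a : Fin (suc k)) (x : Fin k) → toℕ (punchIn a x) ≡ suc (toℕ a) → a ≡ inject₁ x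
punchIn≡suc⇒ 0F      0F      e = refl
punchIn≡suc⇒ (suc a) (suc x) e = cong suc (punchIn≡suc⇒ a x (suc-injective e))

punchIn-inject₁ : ∀ {k} (x : Fin k) → toℕ (punchIn (inject₁ x) x) ≡ suc (toℕ (inject₁ x))
punchIn-inject₁ 0F      = refl
punchIn-inject₁ (suc x) = cong suc (punchIn-inject₁ x)

-- Exactly k! permutations of [k+1] have π_{q+2} = π₁ + 1: the first letter
-- is forced to be one less than the shifted letter at position q+2.
successorCount : ∀ k (q : Fin k) →
  length (filter (λ (π : Word (suc k)) → toℕ (lookup π (suc q)) ℕ.≟ suc (toℕ (lookup π 0F))) (perms (suc k))) ≡ k !
successorCount k q = countByFirstLetter k (λ ρ → inject₁ (lookup ρ q)) _ spec
  where
  spec : ∀ a ρ → (toℕ (lookup (V.map (punchIn a) ρ) q) ≡ suc (toℕ a)) ⇔ (a ≡ inject₁ (lookup ρ q))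
  spec a ρ rewrite lookup-map q (punchIn a) ρ =
    mk⇔ (punchIn≡suc⇒ a (lookup ρ q)) (λ { refl → punchIn-inject₁ (lookup ρ q) })

avoidersOfDecidable : ∀ {n c} {Q : Word n → Set} {D : Pred (Word n) 0ℓ} (D? : Decidable D) →
  (∀ π → IsPerm π → Q π ⇔ D π) → length (filter D? (perms n)) ≡ c → PermCount (λ π → ¬ Q π) (n ! ∸ c)
avoidersOfDecidable {n} {c} {Q} D? QD count =
  rejected , filter⁺ (∁? D?) (perms-unique n) , members , size
  where
  accepted rejected : List (Word n)
  accepted = filter D? (perms n)
  rejected = filter (∁? D?) (perms n)
  members : ∀ π → π ∈L rejected ⇔ (IsPerm π × ¬ Q π)
  members π = mk⇔
    (λ m → let (m′ , ¬d) = ∈-filter⁻ (∁? D?) m ; p = perms-sound n π m′ in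
           p , λ q → ¬d (Equivalence.to (QD π p) q))
    (λ (p , ¬q) → ∈-filter⁺ (∁? D?) (perms-complete n π p) (λ d → ¬q (Equivalence.from (QD π p) d)))
  size : length rejected ≡ n ! ∸ c
  size = begin
    length rejected
      ≡⟨ m+n∸m≡n (length accepted) _ ⟨
    length accepted + length rejected ∸ length accepted
      ≡⟨ cong₂ _∸_ (trans (length-filter-split D? (perms n)) (perms-length n)) count ⟩
    n ! ∸ c
      ∎
    where open ≡-Reasoning

map-unique-on : ∀ {A : Set} (P : A → Set) (f : A → A) → (∀ {x y} → P x → P y → f x ≡ f y → x ≡ y) →
  ∀ {xs} → All P xs → Unique xs → Unique (L.map f xs)
map-unique-on P f inj []         []          = []
map-unique-on P f inj (px ∷ pxs) (x∉ ∷ uxs) =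
  AllP.map⁺ (All.zipWith (λ (py , x≢y) e → x≢y (inj px py e)) (pxs , x∉)) ∷ map-unique-on P f inj pxs uxs

transportCount : ∀ {n N} {P Q : Word n → Set} (f : Word n → Word n) →
  (∀ π → IsPerm π → IsPerm (f π)) → (∀ π → IsPerm π → f (f π) ≡ π) →
  (∀ π → IsPerm π → P π ⇔ Q (f π)) → PermCount P N → PermCount Q N
transportCount {Q = Q} f f-perm f-invol PQ (L , u , members , size) =
  L.map f L , map-unique-on IsPerm f f-injective (All.tabulate (λ m → proj₁ (Equivalence.to (members _) m))) u ,
  members′ , trans (length-map f L) size
  where
  f-injective : ∀ {x y} → IsPerm x → IsPerm y → f x ≡ f y → x ≡ y
  f-injective {x} {y} px py e = trans (sym (f-invol x px)) (trans (cong f e) (f-invol y py))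
  members′ : ∀ π → π ∈L L.map f L ⇔ (IsPerm π × Q π)
  members′ π = mk⇔ to from
    where
    to : π ∈L L.map f L → IsPerm π × Q π
    to m with ∈-map⁻ f m
    ... | ρ , m′ , refl = let (pρ , Pρ) = Equivalence.to (members ρ) m′ in
                          f-perm ρ pρ , Equivalence.to (PQ ρ pρ) Pρ
    from : IsPerm π × Q π → π ∈L L.map f L
    from (p , Qπ) = subst (_∈L L.map f L) (f-invol π p) (∈-map⁺ f (Equivalence.from (members (f π))
      (f-perm π p , Equivalence.from (PQ (f π) (f-perm π p)) (subst Q (sym (f-invol π p)) Qπ))))

PermCount-cong : ∀ {n N} {P Q : Word n → Set} → (∀ π → IsPerm π → P π ⇔ Q π) → PermCount P N → PermCount Q N
PermCount-cong = transportCount id (λ _ p → p) (λ _ _ → refl)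


-- Occurrences of length-2 patterns.

data TwoPattern : Set where
  ⟨_,_,_⟩ : Bool → Subset 3 → Subset 3 → TwoPattern

Ordered : ∀ {n} → Bool → Fin n → Fin n → Set
Ordered true  u v = u F.< v
Ordered false u v = v F.< u

-- For the extended sequence 0 < u+1 < v+1 < n+1, the gaps listed in S have
-- width one.
Adjacent : Subset 3 → ℕ → ℕ → ℕ → Set
Adjacent S u v n = (lookup S 0F ≡ true → u ≡ 0)
                 × (lookup S 1F ≡ true → v ≡ suc u)
                 × (lookup S 2F ≡ true → n ≡ suc v)

-- An occurrence: positions a < c in the prescribed order, the positions and
-- the (sorted) letters meeting the constraints X and Y respectively.
data Occ : TwoPattern → ∀ {n} → Word n → Set where
  occ : ∀ {b X Y n} {π : Word n} (a c : Fin n) → a F.< c → Ordered b (lookup π a) (lookup π c) →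
        Adjacent X (toℕ a) (toℕ c) n →
        Adjacent Y (toℕ (lookup π (if b then a else c))) (toℕ (lookup π (if b then c else a))) n →
        Occ ⟨ b , X , Y ⟩ π

-- The adjacency requirement of 'Defs' for the set S on the sequence
-- 0, f₀, f₁, t (positions i or sorted letters j of an occurrence).
Gaps : Subset 3 → (Fin 2 → ℕ) → ℕ → Set
Gaps S f t = ∀ x → x ∈ S → extend f t (suc x) ≡ suc (extend f t (inject₁ x))

gaps⇔Adjacent : ∀ (S : Subset 3) (f : Fin 2 → ℕ) {u v n : ℕ} → f 0F ≡ suc u → f 1F ≡ suc v →
  Gaps S f (suc n) ⇔ Adjacent S u v n
gaps⇔Adjacent S f {u} {v} {n} f₀ f₁ = mk⇔ to from
  where
  to : Gaps S f (suc n) → Adjacent S u v n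
  to gap = (λ s → suc-injective (trans (sym f₀) (gap 0F (lookup⇒[]= 0F S s))))
         , (λ s → suc-injective (trans (sym f₁) (trans (gap 1F (lookup⇒[]= 1F S s)) (cong suc f₀))))
         , (λ s → suc-injective (trans (gap 2F (lookup⇒[]= 2F S s)) (cong suc f₁)))
  from : Adjacent S u v n → Gaps S f (suc n)
  from (adj₀ , adj₁ , adj₂) 0F s = trans f₀ (cong suc (adj₀ ([]=⇒lookup s)))
  from (adj₀ , adj₁ , adj₂) 1F s = trans f₁ (cong suc (trans (adj₁ ([]=⇒lookup s)) (sym f₀)))
  from (adj₀ , adj₁ , adj₂) 2F s = cong suc (trans (adj₂ ([]=⇒lookup s)) (sym f₁))


-- Mirror images in [n]: u′ = n-1-v and v′ = n-1-u.

opposite-mirror : ∀ {n} (i : Fin n) → toℕ (opposite i) + suc (toℕ i) ≡ n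
opposite-mirror {n} i = trans (cong (_+ suc (toℕ i)) (opposite-prop i)) (m∸n+n≡m (toℕ<n i))

<-mirror : ∀ {u v u′ v′ n} → u′ + suc v ≡ n → v′ + suc u ≡ n → u ℕ.< v → u′ ℕ.< v′
<-mirror {u} {v} {u′} {v′} e₁ e₂ u<v = +-cancelʳ-< (suc u) u′ v′
  (subst (u′ + suc u ℕ.<_) (trans e₁ (sym e₂)) (+-monoʳ-< u′ (s≤s u<v)))

Adjacent-mirror : ∀ (S : Subset 3) {u v u′ v′ n} → u′ + suc v ≡ n → v′ + suc u ≡ n →
  Adjacent S u v n → Adjacent (reflectSet S) u′ v′ n
Adjacent-mirror S {u} {v} {u′} {v′} {n} e₁ e₂ (adj₀ , adj₁ , adj₂) = adj₀′ , adj₁′ , adj₂′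
  where
  adj₀′ : lookup S 2F ≡ true → u′ ≡ 0
  adj₀′ s = +-cancelʳ-≡ (suc v) u′ 0 (trans e₁ (adj₂ s))
  adj₁′ : lookup S 1F ≡ true → v′ ≡ suc u′
  adj₁′ s with adj₁ s
  ... | refl = +-cancelʳ-≡ (suc u) v′ (suc u′) (trans e₂ (trans (sym e₁) (+-suc u′ (suc u))))
  adj₂′ : lookup S 0F ≡ true → n ≡ suc v′
  adj₂′ s with adj₀ s
  ... | refl = trans (sym e₂) (+-comm v′ 1)


record Symmetry : Set where
  field
    onWords            : ∀ {n} → Word n → Word n
    onPatterns         : TwoPattern → TwoPattern
    preservesPerm      : ∀ {n} (π : Word n) → IsPerm π → IsPerm (onWords π)
    wordsInvolutive    : ∀ {n} (π : Word n) → IsPerm π → onWords (onWords π) ≡ π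
    patternsInvolutive : ∀ t → onPatterns (onPatterns t) ≡ t
    carriesOcc         : ∀ t {n} (π : Word n) → IsPerm π → Occ t π → Occ (onPatterns t) (onWords π)

  -- Applying the symmetry twice shows that occurrences are also reflected.
  occ⇔ : ∀ t {n} (π : Word n) → IsPerm π → Occ t π ⇔ Occ (onPatterns t) (onWords π)
  occ⇔ t π p = mk⇔ (carriesOcc t π p) λ o →
    subst₂ (λ s ρ → Occ s ρ) (patternsInvolutive t) (wordsInvolutive π p)
      (carriesOcc (onPatterns t) (onWords π) (preservesPerm π p) o)

avoidersAlong : (S : Symmetry) → ∀ {t t′ n N} → Symmetry.onPatterns S t ≡ t′ →
  PermCount {n} (λ π → ¬ Occ t π) N → PermCount (λ π → ¬ Occ t′ π) N
avoidersAlong S {t} refl = transportCount onWords preservesPerm wordsInvolutive (λ π p → ¬-cong-⇔ (occ⇔ t π p))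
  where open Symmetry S

reflectSet-involutive : ∀ {k} (S : Subset (suc k)) → reflectSet (reflectSet S) ≡ S
reflectSet-involutive S = trans
  (tabulate-cong (λ x → trans (lookup∘tabulate (lookup S ∘ opposite) (opposite x)) (cong (lookup S) (opposite-involutive x))))
  (tabulate∘lookup S)

opposite-injective : ∀ {n} {i j : Fin n} → opposite i ≡ opposite j → i ≡ j
opposite-injective {i = i} {j} e = trans (sym (opposite-involutive i)) (trans (cong opposite e) (opposite-involutive j))

opposite-< : ∀ {n} {u v : Fin n} → u F.< v → opposite v F.< opposite u
opposite-< {u = u} {v} = <-mirror (opposite-mirror v) (opposite-mirror u)

Ordered-swap : ∀ b {n} {u v : Fin n} → Ordered b u v → Ordered (not b) v u
Ordered-swap true  u<v = u<v
Ordered-swap false v<u = v<u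

Ordered-opposite : ∀ b {n} {u v : Fin n} → Ordered b u v → Ordered (not b) (opposite u) (opposite v)
Ordered-opposite true  = opposite-<
Ordered-opposite false = opposite-<

Adjacent-opposite : ∀ (S : Subset 3) {n} {u v : Fin n} →
  Adjacent S (toℕ u) (toℕ v) n → Adjacent (reflectSet S) (toℕ (opposite v)) (toℕ (opposite u)) n
Adjacent-opposite S {u = u} {v} = Adjacent-mirror S (opposite-mirror v) (opposite-mirror u)


-- Reverse: π^r_i = π_{n+1-i}, matching p^r = (σ^r, {k - x}, Y); an
-- occurrence at positions a < c moves to n+1-c < n+1-a.

reverseWord : ∀ {n} → Word n → Word n
reverseWord π = tabulate (λ i → lookup π (opposite i))

lookup-reverseWord : ∀ {n} (π : Word n) i → lookup (reverseWord π) (opposite i) ≡ lookup π i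
lookup-reverseWord π i = trans (lookup∘tabulate (lookup π ∘ opposite) (opposite i)) (cong (lookup π) (opposite-involutive i))

reverseWord-if : ∀ b {n} (π : Word n) a c →
  lookup (reverseWord π) (if not b then opposite c else opposite a) ≡ lookup π (if b then a else c)
reverseWord-if true  π a c = lookup-reverseWord π a
reverseWord-if false π a c = lookup-reverseWord π c

reverseSymmetry : Symmetry
reverseSymmetry = record
  { onWords            = reverseWord
  ; onPatterns         = λ { ⟨ b , X , Y ⟩ → ⟨ not b , reflectSet X , Y ⟩ }
  ; preservesPerm      = λ π p i j e → opposite-injective (p _ _
      (trans (sym (lookup∘tabulate (lookup π ∘ opposite) i)) (trans e (lookup∘tabulate (lookup π ∘ opposite) j))))
  ; wordsInvolutive    = λ π _ → trans (tabulate-cong (lookup-reverseWord π)) (tabulate∘lookup π)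
  ; patternsInvolutive = λ { ⟨ b , X , Y ⟩ →
      cong₂ (λ b′ X′ → ⟨ b′ , X′ , Y ⟩) (not-involutive b) (reflectSet-involutive X) }
  ; carriesOcc         = λ { ⟨ b , X , Y ⟩ π _ (occ a c a<c ord adjX adjY) →
      occ (opposite c) (opposite a) (opposite-< a<c)
          (subst₂ (Ordered (not b)) (sym (lookup-reverseWord π c)) (sym (lookup-reverseWord π a)) (Ordered-swap b ord))
          (Adjacent-opposite X adjX)
          (subst₂ (λ u v → Adjacent Y (toℕ u) (toℕ v) _)
                  (sym (reverseWord-if b π a c)) (sym (reverseWord-if b π c a)) adjY) }
  }


-- Complement: π^c_i = n+1-π_i, matching p^c = (σ^c, X, {k - y}); an
-- occurrence keeps its positions.

complementWord : ∀ {n} → Word n → Word n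
complementWord = V.map opposite

-- The complemented smaller letter is the complement of the larger one.
complementWord-Adjacent : ∀ b (Y : Subset 3) {n} (π : Word n) a c →
  Adjacent Y (toℕ (lookup π (if b then a else c))) (toℕ (lookup π (if b then c else a))) n →
  Adjacent (reflectSet Y) (toℕ (lookup (complementWord π) (if not b then a else c)))
                          (toℕ (lookup (complementWord π) (if not b then c else a))) n
complementWord-Adjacent true  Y π a c adj rewrite lookup-map c opposite π | lookup-map a opposite π = Adjacent-opposite Y adj
complementWord-Adjacent false Y π a c adj rewrite lookup-map c opposite π | lookup-map a opposite π = Adjacent-opposite Y adj

complementSymmetry : Symmetry
complementSymmetry = record
  { onWords            = complementWord
  ; onPatterns         = λ { ⟨ b , X , Y ⟩ → ⟨ not b , X , reflectSet Y ⟩ }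
  ; preservesPerm      = λ π p i j e → p i j (opposite-injective
      (trans (sym (lookup-map i opposite π)) (trans e (lookup-map j opposite π))))
  ; wordsInvolutive    = λ π _ → trans (sym (map-∘ opposite opposite π)) (trans (map-cong opposite-involutive π) (map-id π))
  ; patternsInvolutive = λ { ⟨ b , X , Y ⟩ →
      cong₂ (λ b′ Y′ → ⟨ b′ , X , Y′ ⟩) (not-involutive b) (reflectSet-involutive Y) }
  ; carriesOcc         = λ { ⟨ b , X , Y ⟩ π _ (occ a c a<c ord adjX adjY) →
      occ a c a<c
          (subst₂ (Ordered (not b)) (sym (lookup-map a opposite π)) (sym (lookup-map c opposite π)) (Ordered-opposite b ord))
          adjX (complementWord-Adjacent b Y π a c adjY) }
  }


-- Inverse: π⁻¹ (on all words, via 'positionOf'), matching p^i = (σ⁻¹, Y, X);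
-- positions and letters of an occurrence trade places.

inverseWord : ∀ {n} → Word n → Word n
inverseWord π = tabulate (positionOf π)

inverseWord-lookup : ∀ {n} (π : Word n) → IsPerm π → ∀ i → lookup (inverseWord π) (lookup π i) ≡ i
inverseWord-lookup π p i = trans (lookup∘tabulate (positionOf π) _) (positionOf-lookup π p i)

lookup-inverseWord : ∀ {n} (π : Word n) → IsPerm π → ∀ v → lookup π (lookup (inverseWord π) v) ≡ v
lookup-inverseWord π p v = trans (cong (lookup π) (lookup∘tabulate (positionOf π) v)) (lookup-positionOf π p v)

inverseWord-IsPerm : ∀ {n} (π : Word n) → IsPerm π → IsPerm (inverseWord π)
inverseWord-IsPerm π p v w e = trans (sym (lookup-inverseWord π p v)) (trans (cong (lookup π) e) (lookup-inverseWord π p w))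

inverseWord-involutive : ∀ {n} (π : Word n) → IsPerm π → inverseWord (inverseWord π) ≡ π
inverseWord-involutive π p = trans (tabulate-cong position) (tabulate∘lookup π)
  where
  position : ∀ i → positionOf (inverseWord π) i ≡ lookup π i
  position i = trans (cong (positionOf (inverseWord π)) (sym (inverseWord-lookup π p i)))
                     (positionOf-lookup (inverseWord π) (inverseWord-IsPerm π p) (lookup π i))

-- The occurrence at positions a < c becomes one at positions π_a, π_c (in
-- increasing order), whose letters are a and c.
occ-inverse : ∀ {b X Y n} (π : Word n) → IsPerm π → Occ ⟨ b , X , Y ⟩ π → Occ ⟨ b , Y , X ⟩ (inverseWord π)
occ-inverse {true}  {X} {n = n} π p (occ a c a<c ord adjX adjY) =
  occ (lookup π a) (lookup π c) ord (subst₂ F._<_ (sym (inv a)) (sym (inv c)) a<c) adjY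
      (subst₂ (λ u v → Adjacent X (toℕ u) (toℕ v) n) (sym (inv a)) (sym (inv c)) adjX)
  where
  inv : ∀ i → lookup (inverseWord π) (lookup π i) ≡ i
  inv = inverseWord-lookup π p
occ-inverse {false} {X} {n = n} π p (occ a c a<c ord adjX adjY) =
  occ (lookup π c) (lookup π a) ord (subst₂ (λ u v → v F.< u) (sym (inv c)) (sym (inv a)) a<c) adjY
      (subst₂ (λ u v → Adjacent X (toℕ u) (toℕ v) n) (sym (inv a)) (sym (inv c)) adjX)
  where
  inv : ∀ i → lookup (inverseWord π) (lookup π i) ≡ i
  inv = inverseWord-lookup π p

inverseSymmetry : Symmetry
inverseSymmetry = record
  { onWords            = inverseWord
  ; onPatterns         = λ { ⟨ b , X , Y ⟩ → ⟨ b , Y , X ⟩ }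
  ; preservesPerm      = inverseWord-IsPerm
  ; wordsInvolutive    = inverseWord-involutive
  ; patternsInvolutive = λ { ⟨ b , X , Y ⟩ → refl }
  ; carriesOcc         = λ { ⟨ b , X , Y ⟩ π p o → occ-inverse π p o }
  }


isZero : ∀ {n} → Fin n → Bool
isZero 0F      = true
isZero (suc _) = false

ascending : Permutation′ 2 → Bool
ascending σ = isZero (σ ⟨$⟩ʳ 0F)

shape : Pattern 2 → TwoPattern
shape (pat σ X Y) = ⟨ ascending σ , X , Y ⟩

inverse-from : ∀ {n} (σ : Permutation′ n) {i j} → σ ⟨$⟩ʳ i ≡ j → σ ⟨$⟩ˡ j ≡ i
inverse-from σ e = trans (cong (σ ⟨$⟩ˡ_) (sym e)) (inverseˡ σ)

⟨$⟩ʳ-injective : ∀ {n} (σ : Permutation′ n) {i j} → σ ⟨$⟩ʳ i ≡ σ ⟨$⟩ʳ j → i ≡ j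
⟨$⟩ʳ-injective σ e = trans (sym (inverse-from σ e)) (inverseˡ σ)

data Orientation (σ : Permutation′ 2) : Bool → Set where
  increasing : σ ⟨$⟩ʳ 0F ≡ 0F → σ ⟨$⟩ʳ 1F ≡ 1F → Orientation σ true
  decreasing : σ ⟨$⟩ʳ 0F ≡ 1F → σ ⟨$⟩ʳ 1F ≡ 0F → Orientation σ false

orientation : ∀ σ → Orientation σ (ascending σ)
orientation σ with σ ⟨$⟩ʳ 0F in e₀ | σ ⟨$⟩ʳ 1F in e₁
... | 0F | 1F = increasing e₀ e₁
... | 1F | 0F = decreasing e₀ e₁
... | 0F | 0F = contradiction (⟨$⟩ʳ-injective σ (trans e₀ (sym e₁))) λ ()
... | 1F | 1F = contradiction (⟨$⟩ʳ-injective σ (trans e₀ (sym e₁))) λ ()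

orientation-unique : ∀ {σ b b′} → Orientation σ b → Orientation σ b′ → b ≡ b′
orientation-unique (increasing _ _) (increasing _ _)  = refl
orientation-unique (decreasing _ _) (decreasing _ _)  = refl
orientation-unique (increasing e _) (decreasing e′ _) = contradiction (trans (sym e) e′) λ ()
orientation-unique (decreasing e _) (increasing e′ _) = contradiction (trans (sym e) e′) λ ()

ascending-of : ∀ {σ b} → Orientation σ b → ascending σ ≡ b
ascending-of {σ} = orientation-unique (orientation σ)

flip-orientation : ∀ {σ b} → Orientation σ b → Orientation (flip σ) b
flip-orientation {σ} (increasing e₀ e₁) = increasing (inverse-from σ e₀) (inverse-from σ e₁)
flip-orientation {σ} (decreasing e₀ e₁) = decreasing (inverse-from σ e₁) (inverse-from σ e₀)

reverse-orientation : ∀ {σ b} → Orientation σ b → Orientation (reverse ∘ₚ σ) (not b)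
reverse-orientation (increasing e₀ e₁) = decreasing e₁ e₀
reverse-orientation (decreasing e₀ e₁) = increasing e₁ e₀

complement-orientation : ∀ {σ b} → Orientation σ b → Orientation (σ ∘ₚ reverse) (not b)
complement-orientation (increasing e₀ e₁) = decreasing (cong opposite e₀) (cong opposite e₁)
complement-orientation (decreasing e₀ e₁) = increasing (cong opposite e₀) (cong opposite e₁)

σ-ordered : ∀ {σ b} → Orientation σ b → Ordered b (σ ⟨$⟩ʳ 0F) (σ ⟨$⟩ʳ 1F)
σ-ordered (increasing e₀ e₁) = subst₂ F._<_ (sym e₀) (sym e₁) (s≤s z≤n)
σ-ordered (decreasing e₀ e₁) = subst₂ F._<_ (sym e₁) (sym e₀) (s≤s z≤n)

σ⁻¹-sorts : ∀ {σ b} → Orientation σ b → ∀ m → σ ⟨$⟩ˡ m ≡ (if b then m else opposite m)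
σ⁻¹-sorts {σ} o m = inverse-from σ (values o m)
  where
  values : ∀ {b} → Orientation σ b → ∀ m → σ ⟨$⟩ʳ (if b then m else opposite m) ≡ m
  values (increasing e₀ e₁) 0F = e₀
  values (increasing e₀ e₁) 1F = e₁
  values (decreasing e₀ e₁) 0F = e₁
  values (decreasing e₀ e₁) 1F = e₀

orderIsomorphic₂ : ∀ b {m n} {f : Fin 2 → Fin m} {g : Fin 2 → Fin n} →
  Ordered b (f 0F) (f 1F) → Ordered b (g 0F) (g 1F) → ∀ i j → (f i F.< f j ⇔ g i F.< g j)
orderIsomorphic₂ b f< g< 0F 0F = mk⇔ (⊥-elim ∘ FP.<-irrefl refl) (⊥-elim ∘ FP.<-irrefl refl)
orderIsomorphic₂ b f< g< 1F 1F = mk⇔ (⊥-elim ∘ FP.<-irrefl refl) (⊥-elim ∘ FP.<-irrefl refl)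
orderIsomorphic₂ true  f< g< 0F 1F = mk⇔ (λ _ → g<) (λ _ → f<)
orderIsomorphic₂ true  f< g< 1F 0F = mk⇔ (contradiction f< ∘ FP.<-asym) (contradiction g< ∘ FP.<-asym)
orderIsomorphic₂ false f< g< 0F 1F = mk⇔ (contradiction f< ∘ FP.<-asym) (contradiction g< ∘ FP.<-asym)
orderIsomorphic₂ false f< g< 1F 0F = mk⇔ (λ _ → g<) (λ _ → f<)

pair : ∀ {n} → Fin n → Fin n → Fin 2 → Fin n
pair a c 0F = a
pair a c 1F = c

oriented-contains⇔occ : ∀ {σ b X Y n} (π : Word n) → Orientation σ b →
  Contains (pat σ X Y) π ⇔ Occ ⟨ b , X , Y ⟩ π
oriented-contains⇔occ {σ} {b} {X} {Y} {n} π o = mk⇔ to from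
  where
  -- the m-th smallest letter of the occurrence ι, as used by 'Defs'
  sortedLetter : ∀ (ι : Fin 2 → Fin n) m →
    ℕ.suc (toℕ (lookup π (ι (σ ⟨$⟩ˡ m)))) ≡ ℕ.suc (toℕ (lookup π (if b then ι m else ι (opposite m))))
  sortedLetter ι m = cong (λ i → ℕ.suc (toℕ (lookup π i))) (trans (cong ι (σ⁻¹-sorts o m)) (if-float ι b))

  to : Contains (pat σ X Y) π → Occ ⟨ b , X , Y ⟩ π
  to (ι , ascendingPositions , iso , gapsX , gapsY) =
    occ (ι 0F) (ι 1F) (ascendingPositions 0F 1F (s≤s z≤n)) (ordered b (σ-ordered o))
        (Equivalence.to (gaps⇔Adjacent X _ refl refl) gapsX)
        (Equivalence.to (gaps⇔Adjacent Y _ (sortedLetter ι 0F) (sortedLetter ι 1F)) gapsY)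
    where
    ordered : ∀ b → Ordered b (σ ⟨$⟩ʳ 0F) (σ ⟨$⟩ʳ 1F) → Ordered b (lookup π (ι 0F)) (lookup π (ι 1F))
    ordered true  σ< = Equivalence.from (iso 0F 1F) σ<
    ordered false σ< = Equivalence.from (iso 1F 0F) σ<

  from : Occ ⟨ b , X , Y ⟩ π → Contains (pat σ X Y) π
  from (occ a c a<c ord adjX adjY) =
    pair a c , ascendingPositions , orderIsomorphic₂ b ord (σ-ordered o) ,
    Equivalence.from (gaps⇔Adjacent X _ refl refl) adjX ,
    Equivalence.from (gaps⇔Adjacent Y _ (sortedLetter (pair a c) 0F) (sortedLetter (pair a c) 1F)) (letters b adjY)
    where
    ascendingPositions : ∀ i j → i F.< j → pair a c i F.< pair a c j
    ascendingPositions 0F 1F _ = a<c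
    ascendingPositions 0F 0F ()
    ascendingPositions 1F 0F ()
    ascendingPositions 1F 1F (s≤s ())
    letters : ∀ b → Adjacent Y (toℕ (lookup π (if b then a else c))) (toℕ (lookup π (if b then c else a))) n →
      Adjacent Y (toℕ (lookup π (if b then pair a c 0F else pair a c 1F)))
                 (toℕ (lookup π (if b then pair a c 1F else pair a c 0F))) n
    letters true  adj = adj
    letters false adj = adj

contains⇔occ : ∀ (p : Pattern 2) {n} (π : Word n) → Contains p π ⇔ Occ (shape p) π
contains⇔occ (pat σ X Y) π = oriented-contains⇔occ π (orientation σ)

symmetryClassCount : ∀ {q p : Pattern 2} {n N} → SymClass q p →
  PermCount {n} (λ π → ¬ Occ (shape q) π) N → PermCount (λ π → ¬ Occ (shape p) π) N
symmetryClassCount base count = count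
symmetryClassCount (viaI {pat σ X Y} steps) count = avoidersAlong inverseSymmetry
  (cong (λ b → ⟨ b , Y , X ⟩) (sym (ascending-of (flip-orientation (orientation σ)))))
  (symmetryClassCount steps count)
symmetryClassCount (viaR {pat σ X Y} steps) count = avoidersAlong reverseSymmetry
  (cong (λ b → ⟨ b , reflectSet X , Y ⟩) (sym (ascending-of (reverse-orientation (orientation σ)))))
  (symmetryClassCount steps count)
symmetryClassCount (viaC {pat σ X Y} steps) count = avoidersAlong complementSymmetry
  (cong (λ b → ⟨ b , X , reflectSet Y ⟩) (sym (ascending-of (complement-orientation (orientation σ)))))
  (symmetryClassCount steps count)


-- The base patterns: containment as a condition on one or two letters.

after-first : ∀ {n} {c : Fin (suc n)} → c ≢ 0F → 0 ℕ.< toℕ c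
after-first {c = 0F}    c≢0 = contradiction refl c≢0
after-first {c = suc _} _   = s≤s z≤n

-- For 0 ∈ X, the pattern ⟨12, X, {0}⟩ occurs iff π₁ = 1: an occurrence must
-- start at position 1 with letter 1; conversely any later position c meeting
-- the constraints X supplies the larger letter.
startsWithOne⇔ : ∀ {k} {X : Subset 3} (π : Word (suc k)) → IsPerm π → lookup X 0F ≡ true →
  (c : Fin (suc k)) → c ≢ 0F → Adjacent X 0 (toℕ c) (suc k) →
  Occ ⟨ true , X , set true false false ⟩ π ⇔ lookup π 0F ≡ 0F
startsWithOne⇔ {X = X} π p x₀ c c≢0 adjX = mk⇔ to from
  where
  to : Occ ⟨ true , X , set true false false ⟩ π → lookup π 0F ≡ 0F
  to (occ a _ _ _ (atStart , _) (letterOne , _)) with toℕ-injective {i = a} {j = 0F} (atStart x₀)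
  ... | refl = toℕ-injective (letterOne refl)
  from : lookup π 0F ≡ 0F → Occ ⟨ true , X , set true false false ⟩ π
  from π₁≡1 = occ 0F c (after-first c≢0) (subst (F._< lookup π c) (sym π₁≡1) (after-first πc≢1)) adjX
                  ((λ _ → cong toℕ π₁≡1) , (λ ()) , (λ ()))
    where
    πc≢1 : lookup π c ≢ 0F
    πc≢1 e = c≢0 (p c 0F (trans e (sym π₁≡1)))

-- The letter n-1 of [n], n = m+2.
secondLargest : ∀ m → Fin (suc (suc m))
secondLargest m = inject₁ (fromℕ m)

toℕ-secondLargest : ∀ m → toℕ (secondLargest m) ≡ m
toℕ-secondLargest m = trans (toℕ-inject₁ (fromℕ m)) (toℕ-fromℕ m)

-- ⟨12, {0}, {1,2}⟩ occurs iff π₁ = n-1: the occurrence is π₁ followed by the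
-- letter n, wherever it is.
startsWithSecondLargest⇔ : ∀ {m} (π : Word (suc (suc m))) → IsPerm π →
  Occ ⟨ true , set true false false , set false true true ⟩ π ⇔ lookup π 0F ≡ secondLargest m
startsWithSecondLargest⇔ {m} π p = mk⇔ to from
  where
  to : Occ ⟨ true , set true false false , set false true true ⟩ π → lookup π 0F ≡ secondLargest m
  to (occ a c _ _ (atStart , _) (_ , nextLetter , topLetter)) with toℕ-injective {i = a} {j = 0F} (atStart refl)
  ... | refl = toℕ-injective (trans
        (suc-injective (trans (sym (nextLetter refl)) (suc-injective (sym (topLetter refl)))))
        (sym (toℕ-secondLargest m)))
  from : lookup π 0F ≡ secondLargest m → Occ ⟨ true , set true false false , set false true true ⟩ π
  from π₁≡n-1 with IsPerm-onto π p (fromℕ (suc m))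
  ... | c , πc≡n = occ 0F c (after-first c≢0) (subst₂ ℕ._<_ (sym firstLetter) (sym topLetter) (n<1+n m))
                       ((λ _ → refl) , (λ ()) , (λ ()))
                       ((λ ()) , (λ _ → trans topLetter (cong suc (sym firstLetter))) , (λ _ → cong suc (sym topLetter)))
    where
    firstLetter : toℕ (lookup π 0F) ≡ m
    firstLetter = trans (cong toℕ π₁≡n-1) (toℕ-secondLargest m)
    topLetter : toℕ (lookup π c) ≡ suc m
    topLetter = trans (cong toℕ πc≡n) (toℕ-fromℕ (suc m))
    c≢0 : c ≢ 0F
    c≢0 refl = fromℕ≢inject₁ (trans (sym πc≡n) π₁≡n-1)

successorAt⇔ : ∀ {k} {X : Subset 3} (π : Word (suc k)) → lookup X 0F ≡ true →
  (c : Fin (suc k)) → c ≢ 0F → Adjacent X 0 (toℕ c) (suc k) →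
  (∀ c′ → Adjacent X 0 (toℕ c′) (suc k) → c′ ≡ c) →
  Occ ⟨ true , X , set false true false ⟩ π ⇔ toℕ (lookup π c) ≡ suc (toℕ (lookup π 0F))
successorAt⇔ {X = X} π x₀ c c≢0 adjX forced = mk⇔ to from
  where
  to : Occ ⟨ true , X , set false true false ⟩ π → toℕ (lookup π c) ≡ suc (toℕ (lookup π 0F))
  to (occ a c′ _ _ adj (_ , nextLetter , _)) with toℕ-injective {i = a} {j = 0F} (proj₁ adj x₀)
  ... | refl with forced c′ adj
  ... | refl = nextLetter refl
  from : toℕ (lookup π c) ≡ suc (toℕ (lookup π 0F)) → Occ ⟨ true , X , set false true false ⟩ π
  from next = occ 0F c (after-first c≢0) (subst (toℕ (lookup π 0F) ℕ.<_) (sym next) (n<1+n _)) adjX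
                  ((λ ()) , (λ _ → next) , (λ ()))

last : ∀ m → Fin (suc (suc m))
last m = fromℕ (suc m)

atStart : ∀ {k} → Adjacent (set true true false) 0 1 (suc (suc k))
atStart = (λ _ → refl) , (λ _ → refl) , (λ ())

atStart-unique : ∀ {k} (c : Fin (suc (suc k))) → Adjacent (set true true false) 0 (toℕ c) (suc (suc k)) → c ≡ 1F
atStart-unique c (_ , second , _) = toℕ-injective (second refl)

atEnds : ∀ m → Adjacent (set true false true) 0 (toℕ (last m)) (suc (suc m))
atEnds m = (λ _ → refl) , (λ ()) , (λ _ → cong suc (sym (toℕ-fromℕ (suc m))))

atEnds-unique : ∀ {m} (c : Fin (suc (suc m))) → Adjacent (set true false true) 0 (toℕ c) (suc (suc m)) → c ≡ last m
atEnds-unique {m} c (_ , _ , atEnd) = toℕ-injective (trans (suc-injective (sym (atEnd refl))) (sym (toℕ-fromℕ (suc m))))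

baseCount : ∀ m {q} → Base q → PermCount {suc (suc m)} (λ π → ¬ Occ (shape q) π) (suc (suc m) ! ∸ suc m !)
baseCount m b1 = avoidersOfDecidable (λ π → lookup π 0F FP.≟ 0F)
  (λ π p → startsWithOne⇔ π p refl 1F (λ ()) ((λ _ → refl) , (λ ()) , (λ ())))
  (firstLetterCount (suc m) 0F)
baseCount m b2 = avoidersAlong inverseSymmetry refl (avoidersOfDecidable (λ π → lookup π 0F FP.≟ 0F)
  (λ π p → startsWithOne⇔ π p refl 1F (λ ()) atStart)
  (firstLetterCount (suc m) 0F))
baseCount m b3 = avoidersAlong inverseSymmetry refl (avoidersOfDecidable (λ π → lookup π 0F FP.≟ 0F)
  (λ π p → startsWithOne⇔ π p refl (last m) (λ ()) (atEnds m))
  (firstLetterCount (suc m) 0F))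
baseCount m b4 = avoidersOfDecidable (λ π → lookup π 0F FP.≟ secondLargest m) startsWithSecondLargest⇔
  (firstLetterCount (suc m) (secondLargest m))
baseCount m b5 = avoidersAlong inverseSymmetry refl (avoidersOfDecidable
  (λ π → toℕ (lookup π 1F) ℕ.≟ suc (toℕ (lookup π 0F)))
  (λ π _ → successorAt⇔ π refl 1F (λ ()) atStart atStart-unique)
  (successorCount (suc m) 0F))
baseCount m b6 = avoidersAlong inverseSymmetry refl (avoidersOfDecidable
  (λ π → toℕ (lookup π (last m)) ℕ.≟ suc (toℕ (lookup π 0F)))
  (λ π _ → successorAt⇔ π refl (last m) (λ ()) (atEnds m) atEnds-unique)
  (successorCount (suc m) (fromℕ m)))

mainTheorem4 : ∀ (q p : Pattern 2) → Base q → SymClass q p →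
    ∀ (n : ℕ) → 2 ≤ n → AvoidCount p n (n ! ∸ (n ∸ 1) !)
mainTheorem4 q p isBase steps (suc (suc m)) (s≤s (s≤s _)) =
  PermCount-cong (λ π _ → ¬-cong-⇔ (⇔-sym (contains⇔occ p π))) (symmetryClassCount steps (baseCount m isBase))
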